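{- Let $V:\mathbb R^2\to\mathbb R^5$ be the Veronese map $V(x,y)=(x,y,x^2,xy,y^2)$, let $S\subset\mathbb R^2$, and let $p,q,r\in S$ be non-collinear. Then the affine span of $V(p),V(q),V(r)$ is a $2$-dimensional affine subspace of $\mathbb R^5$ that is an ordinary $2$-flat for $V(S)$.
   Context: A $k$-flat is a $k$-dimensional affine subspace. A $k$-flat is ordinary for a set $X\subset\mathbb R^5$ if it contains exactly $k+1$ points of $X$ and it is the unique $k$-flat containing these $k+1$ points. -}

module Defs where

open import Level using (0ℓ)
open import Data.Nat using (ℕ; zero; suc)
open import Data.Fin using (Fin; zero; suc)
open import Data.Product using (Σ; ∃; _×_; _,_)
open import Data.Sum using (_⊎_)
open import Relation.Nullary using (¬_)
open import Relation.Binary.PropositionalEquality using (_≡_)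
open import Relation.Binary.Structures using (IsStrictTotalOrder)
open import Algebra.Structures using (IsCommutativeRing)

-- The real numbers, axiomatised as a complete ordered field
-- (with propositional equality as the equality of the carrier).
-- Every such structure is (isomorphic to) ℝ, so quantifying over all
-- of them is the same as speaking about ℝ.

record Reals : Set₁ where
  infixl 6 _+_
  infixl 7 _*_
  infix 4 _<_ _≤_
  field
    ℝ      : Set
    _+_    : ℝ → ℝ → ℝ
    _*_    : ℝ → ℝ → ℝ
    -_     : ℝ → ℝ
    0ℝ     : ℝ
    1ℝ     : ℝ
    _<_    : ℝ → ℝ → Set
    isCommutativeRing : IsCommutativeRing _≡_ _+_ _*_ -_ 0ℝ 1ℝ
    0≢1    : ¬ (0ℝ ≡ 1ℝ)
    inverse : ∀ x → ¬ (x ≡ 0ℝ) → Σ ℝ (λ y → x * y ≡ 1ℝ)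
    isStrictTotalOrder : IsStrictTotalOrder _≡_ _<_
    +-mono-< : ∀ {x y} z → x < y → x + z < y + z
    *-pos    : ∀ {x y} → 0ℝ < x → 0ℝ < y → 0ℝ < x * y

  _≤_ : ℝ → ℝ → Set
  x ≤ y = x < y ⊎ x ≡ y

  field
    complete : (A : ℝ → Set) → Σ ℝ A → Σ ℝ (λ b → ∀ x → A x → x ≤ b) →
               Σ ℝ (λ s → (∀ x → A x → x ≤ s) ×
                          (∀ b → (∀ x → A x → x ≤ b) → s ≤ b))

module Geometry (ℛ : Reals) where
  open Reals ℛ

  Pt : ℕ → Set
  Pt n = Fin n → ℝ

  _≈ₚ_ : ∀ {n} → Pt n → Pt n → Set
  u ≈ₚ v = ∀ i → u i ≡ v i

  infixl 6 _⊕_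
  infixr 7 _·_
  _⊕_ : ∀ {n} → Pt n → Pt n → Pt n
  (u ⊕ v) i = u i + v i

  _·_ : ∀ {n} → ℝ → Pt n → Pt n
  (a · v) i = a * v i

  𝟎 : ∀ {n} → Pt n
  𝟎 i = 0ℝ

  sumℝ : ∀ {k} → (Fin k → ℝ) → ℝ
  sumℝ {zero}  f = 0ℝ
  sumℝ {suc k} f = f zero + sumℝ (λ i → f (suc i))

  sumPt : ∀ {n k} → (Fin k → Pt n) → Pt n
  sumPt {n} {zero}  f = 𝟎
  sumPt {n} {suc k} f = f zero ⊕ sumPt (λ i → f (suc i))

  lincomb : ∀ {n k} → (Fin k → ℝ) → (Fin k → Pt n) → Pt n
  lincomb t v = sumPt (λ i → t i · v i)

  LinearlyIndependent : ∀ {n k} → (Fin k → Pt n) → Set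
  LinearlyIndependent v = ∀ t → lincomb t v ≈ₚ 𝟎 → ∀ i → t i ≡ 0ℝ

  Subset : ℕ → Set₁
  Subset n = Pt n → Set

  _≐_ : ∀ {n} → Subset n → Subset n → Set
  P ≐ Q = ∀ x → (P x → Q x) × (Q x → P x)

  IsFlat : ∀ n → ℕ → Subset n → Set
  IsFlat n k F =
    Σ (Pt n) λ x₀ → Σ (Fin k → Pt n) λ v →
      LinearlyIndependent v ×
      (∀ x → (F x → Σ (Fin k → ℝ) λ t → x ≈ₚ (x₀ ⊕ lincomb t v)) ×
             (Σ (Fin k → ℝ) (λ t → x ≈ₚ (x₀ ⊕ lincomb t v)) → F x))

  AffineSpan₃ : ∀ {n} → Pt n → Pt n → Pt n → Subset n
  AffineSpan₃ p q r x =
    Σ ℝ λ a → Σ ℝ λ b → Σ ℝ λ c →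
      (a + b + c ≡ 1ℝ) × (x ≈ₚ ((a · p) ⊕ (b · q) ⊕ (c · r)))

  Collinear : Pt 2 → Pt 2 → Pt 2 → Set₁
  Collinear p q r =
    Σ (Subset 2) λ L → IsFlat 2 1 L × L p × L q × L r

  Image : ∀ {m n} → (Pt m → Pt n) → Subset m → Subset n
  Image f S y = Σ (Pt _) λ s → S s × (y ≈ₚ f s)

  IsOrdinaryFlat : ∀ n k → Subset n → Subset n → Set₁
  IsOrdinaryFlat n k X F =
    IsFlat n k F ×
    Σ (Fin (suc k) → Pt n) λ x →
      (∀ i j → x i ≈ₚ x j → i ≡ j) ×
      (∀ i → X (x i) × F (x i)) ×
      (∀ y → X y → F y → Σ (Fin (suc k)) λ i → y ≈ₚ x i) ×
      (∀ G → IsFlat n k G → (∀ i → G (x i)) → G ≐ F)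

  veronese : Pt 2 → Pt 5
  veronese p zero                         = p zero
  veronese p (suc zero)                   = p (suc zero)
  veronese p (suc (suc zero))             = p zero * p zero
  veronese p (suc (suc (suc zero)))       = p zero * p (suc zero)
  veronese p (suc (suc (suc (suc zero)))) = p (suc zero) * p (suc zero)

-- Suppose V s = α V p + β V q + γ V r with α + β + γ = 1. The linear coordinates of V give
-- s = α p + β q + γ r, and then the quadratic ones say that the covariance matrix of p, q, r
-- weighted by α, β, γ vanishes. With u = q - p and w = r - p, minus that matrix is
-- (β² - β) u uᵀ + β γ (u wᵀ + w uᵀ) + (γ² - γ) w wᵀ, and u, w are independent because p, q, r
-- are not collinear, so β² = β, β γ = 0 and γ² = γ: the weights are those of a vertex and V s
-- is one of the three points. The rest (the span is a 2-flat, and the only 2-flat through the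
-- three points) is linear algebra driven by the determinant of the first two coordinates of
-- q - p and r - p, which V leaves unchanged.
module Submission where

open import Defs
open import Algebra.Bundles using (CommutativeRing)
open import Algebra.Core using (Op₁; Op₂)
open import Algebra.Structures using (IsCommutativeRing)
open import Algebra.Solver.Ring.AlmostCommutativeRing
  using (fromCommutativeRing; _-Raw-AlmostCommutative⟶_)
open import Data.Empty using (⊥-elim)
open import Data.Fin.Base using (Fin)
open import Data.Fin.Patterns using (0F; 1F; 2F; 3F; 4F)
open import Data.Integer.Base as ℤ using (ℤ; -[1+_]; _⊖_; _◃_)
import Data.Integer.Properties as ℤ
open import Data.Maybe.Base using (Maybe; just; nothing)
open import Data.Nat.Base as ℕ using (ℕ; zero; suc)
import Data.Nat.Properties as ℕ
open import Data.Product.Base using (Σ; _×_; _,_; proj₁; proj₂)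
open import Data.Sign.Base as Sign using (Sign)
open import Data.Sum.Base using (_⊎_; inj₁; inj₂)
open import Function.Base using (_∘_)
open import Relation.Binary.PropositionalEquality
open import Relation.Binary.Structures using (IsStrictTotalOrder)
open import Relation.Nullary.Decidable using (yes; no)
open import Relation.Nullary.Negation using (¬_)

-- The ring solver must compute with its coefficients, which abstract reals do not allow, so it
-- is run with integer coefficients interpreted through the canonical homomorphism ℤ → A.
module IntegerCoefficients {a} {A : Set a} {_+_ _*_ : Op₂ A} { -_ : Op₁ A} {0# 1# : A}
         (isCommutativeRing : IsCommutativeRing _≡_ _+_ _*_ -_ 0# 1#) where

  commutativeRing : CommutativeRing a a
  commutativeRing = record { isCommutativeRing = isCommutativeRing }

  open CommutativeRing commutativeRing
    using ( ring; semiring; +-abelianGroup; +-comm; +-assoc; +-identityˡ; +-identityʳ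
          ; -‿inverseʳ; *-comm; *-assoc; *-identityˡ; zeroʳ)
  open import Algebra.Properties.Ring ring using (-1*x≈-x; -‿involutive; -0#≈0#)
  open import Algebra.Properties.AbelianGroup +-abelianGroup using (⁻¹-∙-comm)
  open import Algebra.Properties.Semiring.Mult.TCOptimised semiring
    using (×-homo-+; ×1-homo-*; 1+×) renaming (_×_ to _×ℕ_)
  open ≡-Reasoning

  infixl 6 _-_
  _-_ : Op₂ A
  x - y = x + (- y)

  ν : ℕ → A
  ν n = n ×ℕ 1#

  fromℤ : ℤ → A
  fromℤ (ℤ.+ n)  = ν n
  fromℤ -[1+ n ] = - ν (suc n)

  1+x-[1+y]≡x-y : ∀ x y → (1# + x) - (1# + y) ≡ x - y
  1+x-[1+y]≡x-y x y = begin
    (1# + x) - (1# + y)    ≡⟨ cong₂ _+_ (+-comm x 1#) (⁻¹-∙-comm 1# y) ⟨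
    (x + 1#) + (- 1# - y)  ≡⟨ +-assoc x 1# (- 1# - y) ⟩
    x + (1# + (- 1# - y))  ≡⟨ cong (x +_) (+-assoc 1# (- 1#) (- y)) ⟨
    x + ((1# - 1#) - y)    ≡⟨ cong (λ z → x + (z - y)) (-‿inverseʳ 1#) ⟩
    x + (0# - y)           ≡⟨ cong (x +_) (+-identityˡ (- y)) ⟩
    x - y                  ∎

  ⊖-homo : ∀ m n → fromℤ (m ⊖ n) ≡ ν m - ν n
  ⊖-homo m       zero    = sym (trans (cong (ν m +_) -0#≈0#) (+-identityʳ (ν m)))
  ⊖-homo zero    (suc n) = sym (+-identityˡ _)
  ⊖-homo (suc m) (suc n) = begin
    fromℤ (suc m ⊖ suc n)    ≡⟨ cong fromℤ (ℤ.[1+m]⊖[1+n]≡m⊖n m n) ⟩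
    fromℤ (m ⊖ n)            ≡⟨ ⊖-homo m n ⟩
    ν m - ν n                ≡⟨ 1+x-[1+y]≡x-y (ν m) (ν n) ⟨
    (1# + ν m) - (1# + ν n)  ≡⟨ cong₂ _-_ (1+× m 1#) (1+× n 1#) ⟨
    ν (suc m) - ν (suc n)    ∎

  +-homo : ∀ i j → fromℤ (i ℤ.+ j) ≡ fromℤ i + fromℤ j
  +-homo (ℤ.+ m)  (ℤ.+ n)  = ×-homo-+ 1# m n
  +-homo (ℤ.+ m)  -[1+ n ] = ⊖-homo m (suc n)
  +-homo -[1+ m ] (ℤ.+ n)  = trans (⊖-homo n (suc m)) (+-comm _ _)
  +-homo -[1+ m ] -[1+ n ] = begin
    - ν (suc (suc (m ℕ.+ n)))  ≡⟨ cong (λ k → - ν (suc k)) (ℕ.+-suc m n) ⟨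
    - ν (suc m ℕ.+ suc n)      ≡⟨ cong -_ (×-homo-+ 1# (suc m) (suc n)) ⟩
    - (ν (suc m) + ν (suc n))  ≡⟨ ⁻¹-∙-comm _ _ ⟨
    - ν (suc m) - ν (suc n)    ∎

  -‿homo : ∀ i → fromℤ (ℤ.- i) ≡ - fromℤ i
  -‿homo -[1+ n ]      = sym (-‿involutive _)
  -‿homo (ℤ.+ zero)    = sym -0#≈0#
  -‿homo (ℤ.+ suc n)   = refl

  σ : Sign → A
  σ Sign.+ = 1#
  σ Sign.- = - 1#

  σ-homo : ∀ s t → σ (s Sign.* t) ≡ σ s * σ t
  σ-homo Sign.+ t      = sym (*-identityˡ _)
  σ-homo Sign.- Sign.+ = sym (trans (*-comm _ _) (*-identityˡ _))
  σ-homo Sign.- Sign.- = sym (trans (-1*x≈-x (- 1#)) (-‿involutive 1#))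

  ◃-homo : ∀ s n → fromℤ (s ◃ n) ≡ σ s * ν n
  ◃-homo s      zero    = sym (zeroʳ (σ s))
  ◃-homo Sign.+ (suc n) = sym (*-identityˡ _)
  ◃-homo Sign.- (suc n) = sym (-1*x≈-x _)

  fromℤ≡σ*ν : ∀ i → fromℤ i ≡ σ (ℤ.sign i) * ν ℤ.∣ i ∣
  fromℤ≡σ*ν i = trans (cong fromℤ (sym (ℤ.◃-inverse i))) (◃-homo (ℤ.sign i) ℤ.∣ i ∣)

  *-interchange : ∀ w x y z → (w * x) * (y * z) ≡ (w * y) * (x * z)
  *-interchange w x y z = begin
    (w * x) * (y * z)  ≡⟨ *-assoc w x (y * z) ⟩
    w * (x * (y * z))  ≡⟨ cong (w *_) (*-assoc x y z) ⟨
    w * ((x * y) * z)  ≡⟨ cong (λ u → w * (u * z)) (*-comm x y) ⟩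
    w * ((y * x) * z)  ≡⟨ cong (w *_) (*-assoc y x z) ⟩
    w * (y * (x * z))  ≡⟨ *-assoc w y (x * z) ⟨
    (w * y) * (x * z)  ∎

  *-homo : ∀ i j → fromℤ (i ℤ.* j) ≡ fromℤ i * fromℤ j
  *-homo i j = begin
    fromℤ (i ℤ.* j)
      ≡⟨ ◃-homo (ℤ.sign i Sign.* ℤ.sign j) (ℤ.∣ i ∣ ℕ.* ℤ.∣ j ∣) ⟩
    σ (ℤ.sign i Sign.* ℤ.sign j) * ν (ℤ.∣ i ∣ ℕ.* ℤ.∣ j ∣)
      ≡⟨ cong₂ _*_ (σ-homo (ℤ.sign i) (ℤ.sign j)) (×1-homo-* ℤ.∣ i ∣ ℤ.∣ j ∣) ⟩
    (σ (ℤ.sign i) * σ (ℤ.sign j)) * (ν ℤ.∣ i ∣ * ν ℤ.∣ j ∣)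
      ≡⟨ *-interchange _ _ _ _ ⟩
    (σ (ℤ.sign i) * ν ℤ.∣ i ∣) * (σ (ℤ.sign j) * ν ℤ.∣ j ∣)
      ≡⟨ cong₂ _*_ (fromℤ≡σ*ν i) (fromℤ≡σ*ν j) ⟨
    fromℤ i * fromℤ j
      ∎

  fromℤ-homomorphism : ℤ.+-*-rawRing -Raw-AlmostCommutative⟶ fromCommutativeRing commutativeRing
  fromℤ-homomorphism = record
    { ⟦_⟧ = fromℤ ; +-homo = +-homo ; *-homo = *-homo ; -‿homo = -‿homo
    ; 0-homo = refl ; 1-homo = refl }

  fromℤ-weaklyInjective : ∀ i j → Maybe (fromℤ i ≡ fromℤ j)
  fromℤ-weaklyInjective i j with i ℤ.≟ j
  ... | yes i≡j = just (cong fromℤ i≡j)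
  ... | no  _   = nothing

  open import Algebra.Solver.Ring ℤ.+-*-rawRing (fromCommutativeRing commutativeRing)
    fromℤ-homomorphism fromℤ-weaklyInjective public

module Plane (ℛ : Reals) where
  open Reals ℛ
  open Geometry ℛ
  open IsStrictTotalOrder isStrictTotalOrder using (_≟_)
  open IntegerCoefficients isCommutativeRing
    using (commutativeRing; _-_; solve; _:=_; _:+_; _:*_; _:-_; :-_; con; Polynomial)
  open CommutativeRing commutativeRing
    using (*-comm; *-assoc; *-identityʳ; *-identityˡ; zeroˡ; +-identityˡ)
  open ≡-Reasoning

  :0 :1 : ∀ {m} → Polynomial m
  :0 = con (ℤ.+ 0)
  :1 = con (ℤ.+ 1)

  :det : ∀ {m} → Polynomial m → Polynomial m → Polynomial m → Polynomial m → Polynomial m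
  :det x₀ x₁ y₀ y₁ = x₀ :* y₁ :- x₁ :* y₀

  :lincomb₂ : ∀ {m} → Polynomial m → Polynomial m → Polynomial m → Polynomial m → Polynomial m
  :lincomb₂ t₀ t₁ v₀ v₁ = t₀ :* v₀ :+ (t₁ :* v₁ :+ :0)

  x*y≡0⇒x≡0 : ∀ {x y} → ¬ y ≡ 0ℝ → x * y ≡ 0ℝ → x ≡ 0ℝ
  x*y≡0⇒x≡0 {x} {y} y≢0 xy≡0 with inverse y y≢0
  ... | y⁻¹ , yy⁻¹≡1 = begin
    x              ≡⟨ *-identityʳ x ⟨
    x * 1ℝ         ≡⟨ cong (x *_) yy⁻¹≡1 ⟨
    x * (y * y⁻¹)  ≡⟨ *-assoc x y y⁻¹ ⟨
    (x * y) * y⁻¹  ≡⟨ cong (_* y⁻¹) xy≡0 ⟩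
    0ℝ * y⁻¹       ≡⟨ zeroˡ y⁻¹ ⟩
    0ℝ             ∎

  x*y≡0⇒x≡0⊎y≡0 : ∀ {x y} → x * y ≡ 0ℝ → x ≡ 0ℝ ⊎ y ≡ 0ℝ
  x*y≡0⇒x≡0⊎y≡0 {x} {y} xy≡0 with y ≟ 0ℝ
  ... | yes y≡0 = inj₂ y≡0
  ... | no  y≢0 = inj₁ (x*y≡0⇒x≡0 y≢0 xy≡0)

  x-y≡0⇒x≡y : ∀ {x y} → x - y ≡ 0ℝ → x ≡ y
  x-y≡0⇒x≡y {x} {y} x-y≡0 = begin
    x            ≡⟨ solve 2 (λ x y → x := (x :- y) :+ y) refl x y ⟩
    (x - y) + y  ≡⟨ cong (_+ y) x-y≡0 ⟩
    0ℝ + y       ≡⟨ +-identityˡ y ⟩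
    y            ∎

  x*x-x≡0⇒x≡0⊎x≡1 : ∀ {x} → x * x - x ≡ 0ℝ → x ≡ 0ℝ ⊎ x ≡ 1ℝ
  x*x-x≡0⇒x≡0⊎x≡1 {x} x²-x≡0
    with x*y≡0⇒x≡0⊎y≡0 (trans (solve 1 (λ x → x :* (x :- :1) := x :* x :- x) refl x) x²-x≡0)
  ... | inj₁ x≡0   = inj₁ x≡0
  ... | inj₂ x-1≡0 = inj₂ (x-y≡0⇒x≡y x-1≡0)

  α≡1-β-γ : ∀ {α β γ} → α + β + γ ≡ 1ℝ → α ≡ 1ℝ - β - γ
  α≡1-β-γ {α} {β} {γ} Σ≡1 =
    trans (solve 3 (λ a b c → a := (a :+ b :+ c) :- b :- c) refl α β γ) (cong (λ z → z - β - γ) Σ≡1)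

  ≡a*x-b*y⇒≡0 : ∀ {z x y a b} → z ≡ a * x - b * y → a ≡ 0ℝ → b ≡ 0ℝ → z ≡ 0ℝ
  ≡a*x-b*y⇒≡0 {x = x} {y} z≡ refl refl =
    trans z≡ (solve 2 (λ x y → :0 :* x :- :0 :* y := :0) refl x y)

  ≡a*x-b*y+c*z⇒≡0 : ∀ {t x y z a b c} → t ≡ a * x - b * y + c * z →
                    a ≡ 0ℝ → b ≡ 0ℝ → c ≡ 0ℝ → t ≡ 0ℝ
  ≡a*x-b*y+c*z⇒≡0 {x = x} {y} {z} t≡ refl refl refl =
    trans t≡ (solve 3 (λ x y z → :0 :* x :- :0 :* y :+ :0 :* z := :0) refl x y z)

  infixl 6 _⊝_
  _⊝_ : ∀ {n} → Pt n → Pt n → Pt n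
  (u ⊝ v) i = u i - v i

  det : ∀ {n} → Pt (2 ℕ.+ n) → Pt (2 ℕ.+ n) → ℝ
  det u v = u 0F * v 1F - u 1F * v 0F

  area : ∀ {n} → Pt (2 ℕ.+ n) → Pt (2 ℕ.+ n) → Pt (2 ℕ.+ n) → ℝ
  area P Q R = det (Q ⊝ P) (R ⊝ P)

  area-cong : ∀ {n} {P P′ Q Q′ R R′ : Pt (2 ℕ.+ n)} → P ≈ₚ P′ → Q ≈ₚ Q′ → R ≈ₚ R′ →
              area P Q R ≡ area P′ Q′ R′
  area-cong P≈ Q≈ R≈ =
    cong₂ _-_ (cong₂ _*_ (edge Q≈ 0F) (edge R≈ 1F)) (cong₂ _*_ (edge Q≈ 1F) (edge R≈ 0F))
    where
    edge : ∀ {X X′} → X ≈ₚ X′ → ∀ j → X j - _ ≡ X′ j - _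
    edge X≈ j = cong₂ _-_ (X≈ j) (P≈ j)

  det≢0⇒independent : ∀ {n} (v : Fin 2 → Pt (2 ℕ.+ n)) → ¬ det (v 0F) (v 1F) ≡ 0ℝ →
                      LinearlyIndependent v
  det≢0⇒independent v det≢0 t tv≈0 0F = x*y≡0⇒x≡0 det≢0 (≡a*x-b*y⇒≡0
    (solve 6 (λ t₀ t₁ u₀ u₁ w₀ w₁ →
       t₀ :* :det u₀ u₁ w₀ w₁ := :lincomb₂ t₀ t₁ u₀ w₀ :* w₁ :- :lincomb₂ t₀ t₁ u₁ w₁ :* w₀)
     refl (t 0F) (t 1F) (v 0F 0F) (v 0F 1F) (v 1F 0F) (v 1F 1F))
    (tv≈0 0F) (tv≈0 1F))
  det≢0⇒independent v det≢0 t tv≈0 1F = x*y≡0⇒x≡0 det≢0 (≡a*x-b*y⇒≡0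
    (solve 6 (λ t₀ t₁ u₀ u₁ w₀ w₁ →
       t₁ :* :det u₀ u₁ w₀ w₁ := :lincomb₂ t₀ t₁ u₁ w₁ :* u₀ :- :lincomb₂ t₀ t₁ u₀ w₀ :* u₁)
     refl (t 0F) (t 1F) (v 0F 0F) (v 0F 1F) (v 1F 0F) (v 1F 1F))
    (tv≈0 1F) (tv≈0 0F))

  Nonzero : ∀ {n} → Pt n → Set
  Nonzero {n} d = Σ (Fin n) λ i → ¬ d i ≡ 0ℝ

  nonzero? : (u : Pt 2) → Nonzero u ⊎ u ≈ₚ 𝟎
  nonzero? u with u 0F ≟ 0ℝ | u 1F ≟ 0ℝ
  ... | no  u₀≢0 | _        = inj₁ (0F , u₀≢0)
  ... | yes _    | no u₁≢0  = inj₁ (1F , u₁≢0)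
  ... | yes u₀≡0 | yes u₁≡0 = inj₂ λ { 0F → u₀≡0 ; 1F → u₁≡0 }

  nonzero⇒independent : ∀ {n} {d : Pt n} → Nonzero d → LinearlyIndependent (λ (_ : Fin 1) → d)
  nonzero⇒independent {d = d} (i , dᵢ≢0) t td≈0 0F =
    x*y≡0⇒x≡0 dᵢ≢0 (trans (solve 2 (λ x y → x :* y := x :* y :+ :0) refl (t 0F) (d i)) (td≈0 i))

  det≡0⇒cross : ∀ {u w : Pt 2} → det u w ≡ 0ℝ → ∀ i j → w j * u i ≡ w i * u j
  det≡0⇒cross det≡0 0F 0F = refl
  det≡0⇒cross det≡0 1F 1F = refl
  det≡0⇒cross {u} {w} det≡0 0F 1F = begin
    w 1F * u 0F  ≡⟨ *-comm (w 1F) (u 0F) ⟩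
    u 0F * w 1F  ≡⟨ x-y≡0⇒x≡y det≡0 ⟩
    u 1F * w 0F  ≡⟨ *-comm (u 1F) (w 0F) ⟩
    w 0F * u 1F  ∎
  det≡0⇒cross {u} {w} det≡0 1F 0F = sym (det≡0⇒cross {u} {w} det≡0 0F 1F)

  det≡0⇒multiple : ∀ {u w : Pt 2} {i} → ¬ u i ≡ 0ℝ → det u w ≡ 0ℝ → Σ ℝ λ b → w ≈ₚ (b · u)
  det≡0⇒multiple {u} {w} {i} uᵢ≢0 det≡0 with inverse (u i) uᵢ≢0
  ... | k , uᵢk≡1 = w i * k , λ j → begin
    w j              ≡⟨ *-identityʳ (w j) ⟨
    w j * 1ℝ         ≡⟨ cong (w j *_) uᵢk≡1 ⟨
    w j * (u i * k)  ≡⟨ *-assoc (w j) (u i) k ⟨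
    (w j * u i) * k  ≡⟨ cong (_* k) (det≡0⇒cross det≡0 i j) ⟩
    (w i * u j) * k  ≡⟨ solve 3 (λ x y z → (x :* y) :* z := (x :* z) :* y) refl (w i) (u j) k ⟩
    (w i * k) * u j  ∎

  Parallel : Pt 2 → Pt 2 → Set
  Parallel u w = Σ (Pt 2) λ d → Nonzero d × Σ ℝ λ a → Σ ℝ λ b → u ≈ₚ (a · d) × w ≈ₚ (b · d)

  det≡0⇒parallel : ∀ u w → det u w ≡ 0ℝ → Parallel u w
  det≡0⇒parallel u w det≡0 with nonzero? u | nonzero? w
  ... | inj₁ (i , uᵢ≢0) | _ =
    u , (i , uᵢ≢0) , 1ℝ , proj₁ w∥u , (λ j → sym (*-identityˡ (u j))) , proj₂ w∥u
    where w∥u = det≡0⇒multiple uᵢ≢0 det≡0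
  ... | inj₂ u≈0 | inj₁ w≢0 =
    w , w≢0 , 0ℝ , 1ℝ , (λ j → trans (u≈0 j) (sym (zeroˡ (w j)))) , (λ j → sym (*-identityˡ (w j)))
  ... | inj₂ u≈0 | inj₂ w≈0 =
    (λ _ → 1ℝ) , (0F , λ 1≡0 → 0≢1 (sym 1≡0)) , 0ℝ , 0ℝ ,
    (λ j → trans (u≈0 j) (sym (zeroˡ 1ℝ))) , (λ j → trans (w≈0 j) (sym (zeroˡ 1ℝ)))

  affine : ∀ {n k} → Pt n → (Fin k → Pt n) → Pt k → Pt n
  affine x₀ v t = x₀ ⊕ lincomb t v

  Range : ∀ {k n} → (Pt k → Pt n) → Subset n
  Range {k} f x = Σ (Pt k) λ t → x ≈ₚ f t

  area≡0⇒collinear : ∀ {p q r} → area p q r ≡ 0ℝ → Collinear p q r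
  area≡0⇒collinear {p} {q} {r} area≡0 with det≡0⇒parallel (q ⊝ p) (r ⊝ p) area≡0
  ... | d , d≢0 , a , b , q-p≈ad , r-p≈bd =
    Range (affine p v) , (p , v , nonzero⇒independent d≢0 , λ _ → (λ x → x) , (λ x → x)) ,
    on-line {c = 0ℝ} (λ j → trans (solve 1 (λ x → x :- x := :0) refl (p j)) (sym (zeroˡ (d j)))) ,
    on-line q-p≈ad , on-line r-p≈bd
    where
    v : Fin 1 → Pt 2
    v _ = d
    on-line : ∀ {x c} → (x ⊝ p) ≈ₚ (c · d) → Range (affine p v) x
    on-line {x} {c} x-p≈cd = (λ _ → c) , λ j → begin
      x j                       ≡⟨ solve 2 (λ x y → x := y :+ ((x :- y) :+ :0)) refl (x j) (p j) ⟩
      p j + ((x j - p j) + 0ℝ)  ≡⟨ cong (λ z → p j + (z + 0ℝ)) (x-p≈cd j) ⟩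
      p j + (c * d j + 0ℝ)      ∎

  ¬collinear⇒area≢0 : ∀ {p q r} → ¬ Collinear p q r → ¬ area p q r ≡ 0ℝ
  ¬collinear⇒area≢0 ¬collinear area≡0 = ¬collinear (area≡0⇒collinear area≡0)

  ≐-sym : ∀ {n} {F G : Subset n} → F ≐ G → G ≐ F
  ≐-sym F≐G x = proj₂ (F≐G x) , proj₁ (F≐G x)

  ≐-trans : ∀ {n} {F G H : Subset n} → F ≐ G → G ≐ H → F ≐ H
  ≐-trans F≐G G≐H x = (λ Fx → proj₁ (G≐H x) (proj₁ (F≐G x) Fx)) ,
                      (λ Hx → proj₂ (F≐G x) (proj₂ (G≐H x) Hx))

  affineSpan₃-mono : ∀ {n} {P P′ Q Q′ R R′ : Pt n} → P ≈ₚ P′ → Q ≈ₚ Q′ → R ≈ₚ R′ →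
                     ∀ {x} → AffineSpan₃ P Q R x → AffineSpan₃ P′ Q′ R′ x
  affineSpan₃-mono P≈ Q≈ R≈ (α , β , γ , Σ≡1 , x≈) = α , β , γ , Σ≡1 , λ j →
    trans (x≈ j) (cong₂ _+_ (cong₂ _+_ (cong (α *_) (P≈ j)) (cong (β *_) (Q≈ j))) (cong (γ *_) (R≈ j)))

  affineSpan₃-cong : ∀ {n} {P P′ Q Q′ R R′ : Pt n} → P ≈ₚ P′ → Q ≈ₚ Q′ → R ≈ₚ R′ →
                     AffineSpan₃ P Q R ≐ AffineSpan₃ P′ Q′ R′
  affineSpan₃-cong P≈ Q≈ R≈ x =
    affineSpan₃-mono P≈ Q≈ R≈ , affineSpan₃-mono (sym ∘ P≈) (sym ∘ Q≈) (sym ∘ R≈)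

  affine-cong : ∀ {n} (x₀ : Pt n) (v : Fin 2 → Pt n) {s t : Pt 2} → s ≈ₚ t →
                affine x₀ v s ≈ₚ affine x₀ v t
  affine-cong x₀ v s≈t j =
    cong (x₀ j +_) (cong₂ (λ a b → a * v 0F j + (b * v 1F j + 0ℝ)) (s≈t 0F) (s≈t 1F))

  affine-affineCombination : ∀ {n} (x₀ : Pt n) (v : Fin 2 → Pt n) {α β γ} (a b c : Pt 2) →
    α + β + γ ≡ 1ℝ →
    affine x₀ v (α · a ⊕ β · b ⊕ γ · c) ≈ₚ (α · affine x₀ v a ⊕ β · affine x₀ v b ⊕ γ · affine x₀ v c)
  affine-affineCombination x₀ v {β = β} {γ} a b c Σ≡1 j with refl ← α≡1-β-γ Σ≡1 =
    solve 11 (λ β γ x v₀ v₁ a₀ a₁ b₀ b₁ c₀ c₁ →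
      let α = :1 :- β :- γ
          φ : _ → _ → _
          φ s₀ s₁ = x :+ :lincomb₂ s₀ s₁ v₀ v₁
      in φ (α :* a₀ :+ β :* b₀ :+ γ :* c₀) (α :* a₁ :+ β :* b₁ :+ γ :* c₁)
         := α :* φ a₀ a₁ :+ β :* φ b₀ b₁ :+ γ :* φ c₀ c₁)
      refl β γ (x₀ j) (v 0F j) (v 1F j) (a 0F) (a 1F) (b 0F) (b 1F) (c 0F) (c 1F)

  area≢0⇒spans : ∀ {a b c : Pt 2} → ¬ area a b c ≡ 0ℝ → ∀ s → AffineSpan₃ a b c s
  area≢0⇒spans {a} {b} {c} area≢0 s with inverse (area a b c) area≢0
  ... | k , area*k≡1 =
    1ℝ - λ₁ - λ₂ , λ₁ , λ₂ , solve 2 (λ x y → :1 :- x :- y :+ x :+ y := :1) refl λ₁ λ₂ , λ j → begin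
      s j
        ≡⟨ solve 2 (λ s a → s := a :+ (s :- a) :* :1) refl (s j) (a j) ⟩
      a j + (s j - a j) * 1ℝ
        ≡⟨ cong (λ z → a j + (s j - a j) * z) area*k≡1 ⟨
      a j + (s j - a j) * (area a b c * k)
        ≡⟨ cramer j ⟩
      (1ℝ - λ₁ - λ₂) * a j + λ₁ * b j + λ₂ * c j
        ∎
    where
    -- Cramer's rule for s - a = λ₁ (b - a) + λ₂ (c - a).
    λ₁ λ₂ : ℝ
    λ₁ = det (s ⊝ a) (c ⊝ a) * k
    λ₂ = det (b ⊝ a) (s ⊝ a) * k
    cramer : ∀ j → a j + (s j - a j) * (area a b c * k) ≡ (1ℝ - λ₁ - λ₂) * a j + λ₁ * b j + λ₂ * c j
    cramer 0F = solve 9 (λ a₀ a₁ b₀ b₁ c₀ c₁ s₀ s₁ k →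
      let λ₁ = :det (s₀ :- a₀) (s₁ :- a₁) (c₀ :- a₀) (c₁ :- a₁) :* k
          λ₂ = :det (b₀ :- a₀) (b₁ :- a₁) (s₀ :- a₀) (s₁ :- a₁) :* k
      in a₀ :+ (s₀ :- a₀) :* (:det (b₀ :- a₀) (b₁ :- a₁) (c₀ :- a₀) (c₁ :- a₁) :* k)
         := (:1 :- λ₁ :- λ₂) :* a₀ :+ λ₁ :* b₀ :+ λ₂ :* c₀)
      refl (a 0F) (a 1F) (b 0F) (b 1F) (c 0F) (c 1F) (s 0F) (s 1F) k
    cramer 1F = solve 9 (λ a₀ a₁ b₀ b₁ c₀ c₁ s₀ s₁ k →
      let λ₁ = :det (s₀ :- a₀) (s₁ :- a₁) (c₀ :- a₀) (c₁ :- a₁) :* k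
          λ₂ = :det (b₀ :- a₀) (b₁ :- a₁) (s₀ :- a₀) (s₁ :- a₁) :* k
      in a₁ :+ (s₁ :- a₁) :* (:det (b₀ :- a₀) (b₁ :- a₁) (c₀ :- a₀) (c₁ :- a₁) :* k)
         := (:1 :- λ₁ :- λ₂) :* a₁ :+ λ₁ :* b₁ :+ λ₂ :* c₁)
      refl (a 0F) (a 1F) (b 0F) (b 1F) (c 0F) (c 1F) (s 0F) (s 1F) k

  area-affine : ∀ {n} (x₀ : Pt (2 ℕ.+ n)) (v : Fin 2 → Pt (2 ℕ.+ n)) (a b c : Pt 2) →
    area (affine x₀ v a) (affine x₀ v b) (affine x₀ v c) ≡ area a b c * det (v 0F) (v 1F)
  area-affine x₀ v a b c =
    solve 12 (λ x₀ x₁ v₀₀ v₀₁ v₁₀ v₁₁ a₀ a₁ b₀ b₁ c₀ c₁ →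
      let φ₀ : _ → _ → _
          φ₀ s₀ s₁ = x₀ :+ :lincomb₂ s₀ s₁ v₀₀ v₁₀
          φ₁ : _ → _ → _
          φ₁ s₀ s₁ = x₁ :+ :lincomb₂ s₀ s₁ v₀₁ v₁₁
      in :det (φ₀ b₀ b₁ :- φ₀ a₀ a₁) (φ₁ b₀ b₁ :- φ₁ a₀ a₁) (φ₀ c₀ c₁ :- φ₀ a₀ a₁) (φ₁ c₀ c₁ :- φ₁ a₀ a₁)
         := :det (b₀ :- a₀) (b₁ :- a₁) (c₀ :- a₀) (c₁ :- a₁) :* :det v₀₀ v₀₁ v₁₀ v₁₁)
      refl (x₀ 0F) (x₀ 1F) (v 0F 0F) (v 0F 1F) (v 1F 0F) (v 1F 1F)
      (a 0F) (a 1F) (b 0F) (b 1F) (c 0F) (c 1F)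

  range≐affineSpan₃ : ∀ {n} (x₀ : Pt n) (v : Fin 2 → Pt n) (a b c : Pt 2) → ¬ area a b c ≡ 0ℝ →
    Range (affine x₀ v) ≐ AffineSpan₃ (affine x₀ v a) (affine x₀ v b) (affine x₀ v c)
  range≐affineSpan₃ x₀ v a b c area≢0 x = to , from
    where
    φ = affine x₀ v
    to : Range φ x → AffineSpan₃ (φ a) (φ b) (φ c) x
    to (s , x≈φs) with area≢0⇒spans {a} {b} {c} area≢0 s
    ... | α , β , γ , Σ≡1 , s≈ = α , β , γ , Σ≡1 , λ j →
      trans (x≈φs j) (trans (affine-cong x₀ v s≈ j) (affine-affineCombination x₀ v a b c Σ≡1 j))
    from : AffineSpan₃ (φ a) (φ b) (φ c) x → Range φ x
    from (α , β , γ , Σ≡1 , x≈) =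
      α · a ⊕ β · b ⊕ γ · c , λ j → trans (x≈ j) (sym (affine-affineCombination x₀ v a b c Σ≡1 j))

  edges : ∀ {n} → Pt n → Pt n → Pt n → Fin 2 → Pt n
  edges P Q R 0F = Q ⊝ P
  edges P Q R 1F = R ⊝ P

  e₀ e₁ e₂ : Pt 2
  e₀ _  = 0ℝ
  e₁ 0F = 1ℝ
  e₁ 1F = 0ℝ
  e₂ 0F = 0ℝ
  e₂ 1F = 1ℝ

  area-e₀e₁e₂≢0 : ¬ area e₀ e₁ e₂ ≡ 0ℝ
  area-e₀e₁e₂≢0 area≡0 =
    0≢1 (trans (sym area≡0) (solve 0 (:det (:1 :- :0) (:0 :- :0) (:0 :- :0) (:1 :- :0) := :1) refl))

  area≢0⇒isFlat : ∀ {n} {P Q R : Pt (2 ℕ.+ n)} → ¬ area P Q R ≡ 0ℝ →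
                  IsFlat (2 ℕ.+ n) 2 (AffineSpan₃ P Q R)
  area≢0⇒isFlat {P = P} {Q} {R} area≢0 =
    P , edges P Q R , det≢0⇒independent (edges P Q R) area≢0 ,
    ≐-sym (≐-trans (range≐affineSpan₃ P (edges P Q R) e₀ e₁ e₂ area-e₀e₁e₂≢0)
                   (affineSpan₃-cong φe₀≈P φe₁≈Q φe₂≈R))
    where
    φ = affine P (edges P Q R)
    φe₀≈P : φ e₀ ≈ₚ P
    φe₀≈P j = solve 3 (λ p q r → p :+ :lincomb₂ :0 :0 (q :- p) (r :- p) := p) refl (P j) (Q j) (R j)
    φe₁≈Q : φ e₁ ≈ₚ Q
    φe₁≈Q j = solve 3 (λ p q r → p :+ :lincomb₂ :1 :0 (q :- p) (r :- p) := q) refl (P j) (Q j) (R j)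
    φe₂≈R : φ e₂ ≈ₚ R
    φe₂≈R j = solve 3 (λ p q r → p :+ :lincomb₂ :0 :1 (q :- p) (r :- p) := r) refl (P j) (Q j) (R j)

  flat∋triangle⇒≐affineSpan₃ : ∀ {n} {P Q R : Pt (2 ℕ.+ n)} {G : Subset (2 ℕ.+ n)} →
    ¬ area P Q R ≡ 0ℝ → IsFlat (2 ℕ.+ n) 2 G → G P → G Q → G R → G ≐ AffineSpan₃ P Q R
  flat∋triangle⇒≐affineSpan₃ {P = P} {Q} {R} area≢0 (x₀ , v , _ , G≐range) GP GQ GR
    with proj₁ (G≐range P) GP | proj₁ (G≐range Q) GQ | proj₁ (G≐range R) GR
  ... | a , P≈φa | b , Q≈φb | c , R≈φc =
    ≐-trans G≐range (≐-trans (range≐affineSpan₃ x₀ v a b c area-abc≢0)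
                             (affineSpan₃-cong (sym ∘ P≈φa) (sym ∘ Q≈φb) (sym ∘ R≈φc)))
    where
    area-abc≢0 : ¬ area a b c ≡ 0ℝ
    area-abc≢0 area≡0 = area≢0 (begin
      area P Q R                                            ≡⟨ area-cong P≈φa Q≈φb R≈φc ⟩
      area (affine x₀ v a) (affine x₀ v b) (affine x₀ v c)  ≡⟨ area-affine x₀ v a b c ⟩
      area a b c * det (v 0F) (v 1F)                        ≡⟨ cong (_* det (v 0F) (v 1F)) area≡0 ⟩
      0ℝ * det (v 0F) (v 1F)                                ≡⟨ zeroˡ _ ⟩
      0ℝ                                                    ∎)

  triangle : ∀ {n} → Pt n → Pt n → Pt n → Fin 3 → Pt n
  triangle P Q R 0F = P
  triangle P Q R 1F = Q
  triangle P Q R 2F = R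

  area≢0⇒triangle-injective : ∀ {n} {P Q R : Pt (2 ℕ.+ n)} → ¬ area P Q R ≡ 0ℝ →
                              ∀ i j → triangle P Q R i ≈ₚ triangle P Q R j → i ≡ j
  area≢0⇒triangle-injective {P = P} {Q} {R} area≢0 = injective
    where
    P≉Q : ¬ P ≈ₚ Q
    P≉Q P≈Q = area≢0 (trans
      (area-cong {P′ = P} {Q′ = P} {R′ = R} (λ _ → refl) (sym ∘ P≈Q) (λ _ → refl))
      (solve 4 (λ p₀ p₁ r₀ r₁ → :det (p₀ :- p₀) (p₁ :- p₁) (r₀ :- p₀) (r₁ :- p₁) := :0)
               refl (P 0F) (P 1F) (R 0F) (R 1F)))
    P≉R : ¬ P ≈ₚ R
    P≉R P≈R = area≢0 (trans
      (area-cong {P′ = P} {Q′ = Q} {R′ = P} (λ _ → refl) (λ _ → refl) (sym ∘ P≈R))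
      (solve 4 (λ p₀ p₁ q₀ q₁ → :det (q₀ :- p₀) (q₁ :- p₁) (p₀ :- p₀) (p₁ :- p₁) := :0)
               refl (P 0F) (P 1F) (Q 0F) (Q 1F)))
    Q≉R : ¬ Q ≈ₚ R
    Q≉R Q≈R = area≢0 (trans
      (area-cong {P′ = P} {Q′ = Q} {R′ = Q} (λ _ → refl) (λ _ → refl) (sym ∘ Q≈R))
      (solve 4 (λ p₀ p₁ q₀ q₁ → :det (q₀ :- p₀) (q₁ :- p₁) (q₀ :- p₀) (q₁ :- p₁) := :0)
               refl (P 0F) (P 1F) (Q 0F) (Q 1F)))
    injective : ∀ i j → triangle P Q R i ≈ₚ triangle P Q R j → i ≡ j
    injective 0F 0F _   = refl
    injective 1F 1F _   = refl
    injective 2F 2F _   = refl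
    injective 0F 1F P≈Q = ⊥-elim (P≉Q P≈Q)
    injective 1F 0F Q≈P = ⊥-elim (P≉Q (sym ∘ Q≈P))
    injective 0F 2F P≈R = ⊥-elim (P≉R P≈R)
    injective 2F 0F R≈P = ⊥-elim (P≉R (sym ∘ R≈P))
    injective 1F 2F Q≈R = ⊥-elim (Q≉R Q≈R)
    injective 2F 1F R≈Q = ⊥-elim (Q≉R (sym ∘ R≈Q))

  affineSpan₃∋triangle : ∀ {n} {P Q R : Pt n} i → AffineSpan₃ P Q R (triangle P Q R i)
  affineSpan₃∋triangle {P = P} {Q} {R} 0F = 1ℝ , 0ℝ , 0ℝ , solve 0 (:1 :+ :0 :+ :0 := :1) refl ,
    λ j → solve 3 (λ p q r → p := :1 :* p :+ :0 :* q :+ :0 :* r) refl (P j) (Q j) (R j)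
  affineSpan₃∋triangle {P = P} {Q} {R} 1F = 0ℝ , 1ℝ , 0ℝ , solve 0 (:0 :+ :1 :+ :0 := :1) refl ,
    λ j → solve 3 (λ p q r → q := :0 :* p :+ :1 :* q :+ :0 :* r) refl (P j) (Q j) (R j)
  affineSpan₃∋triangle {P = P} {Q} {R} 2F = 0ℝ , 0ℝ , 1ℝ , solve 0 (:0 :+ :0 :+ :1 := :1) refl ,
    λ j → solve 3 (λ p q r → r := :0 :* p :+ :0 :* q :+ :1 :* r) refl (P j) (Q j) (R j)

  image∋triangle : ∀ {m n} {f : Pt m → Pt n} {S : Subset m} {p q r} → S p → S q → S r →
                   ∀ i → Image f S (triangle (f p) (f q) (f r) i)
  image∋triangle {p = p} Sp Sq Sr 0F = p , Sp , λ _ → refl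
  image∋triangle {q = q} Sp Sq Sr 1F = q , Sq , λ _ → refl
  image∋triangle {r = r} Sp Sq Sr 2F = r , Sr , λ _ → refl

  Vertex : ℝ → ℝ → ℝ → Set
  Vertex α β γ = (α ≡ 1ℝ × β ≡ 0ℝ × γ ≡ 0ℝ) ⊎
                 (α ≡ 0ℝ × β ≡ 1ℝ × γ ≡ 0ℝ) ⊎
                 (α ≡ 0ℝ × β ≡ 0ℝ × γ ≡ 1ℝ)

  vertex⇒≈triangle : ∀ {n} {α β γ} {P Q R : Pt n} → Vertex α β γ →
                     Σ (Fin 3) λ i → (α · P ⊕ β · Q ⊕ γ · R) ≈ₚ triangle P Q R i
  vertex⇒≈triangle {P = P} {Q} {R} (inj₁ (refl , refl , refl)) =
    0F , λ j → solve 3 (λ p q r → :1 :* p :+ :0 :* q :+ :0 :* r := p) refl (P j) (Q j) (R j)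
  vertex⇒≈triangle {P = P} {Q} {R} (inj₂ (inj₁ (refl , refl , refl))) =
    1F , λ j → solve 3 (λ p q r → :0 :* p :+ :1 :* q :+ :0 :* r := q) refl (P j) (Q j) (R j)
  vertex⇒≈triangle {P = P} {Q} {R} (inj₂ (inj₂ (refl , refl , refl))) =
    2F , λ j → solve 3 (λ p q r → :0 :* p :+ :0 :* q :+ :1 :* r := r) refl (P j) (Q j) (R j)

  idempotent-weights⇒vertex : ∀ {α β γ} → α + β + γ ≡ 1ℝ →
    β * β - β ≡ 0ℝ → β * γ ≡ 0ℝ → γ * γ - γ ≡ 0ℝ → Vertex α β γ
  idempotent-weights⇒vertex {γ = γ} Σ≡1 β²-β≡0 βγ≡0 γ²-γ≡0
    with refl ← α≡1-β-γ Σ≡1 | x*x-x≡0⇒x≡0⊎x≡1 β²-β≡0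
  ... | inj₂ refl =
    inj₂ (inj₁ (trans (cong (λ c → 1ℝ - 1ℝ - c) γ≡0) (solve 0 (:1 :- :1 :- :0 := :0) refl) ,
                refl , γ≡0))
    where γ≡0 = trans (sym (*-identityˡ γ)) βγ≡0
  ... | inj₁ refl with x*x-x≡0⇒x≡0⊎x≡1 γ²-γ≡0
  ...   | inj₁ refl = inj₁ (solve 0 (:1 :- :0 :- :0 := :1) refl , refl , refl)
  ...   | inj₂ refl = inj₂ (inj₂ (solve 0 (:1 :- :0 :- :1 := :0) refl , refl , refl))

  form : ℝ → ℝ → ℝ → Pt 2 → Pt 2 → Fin 2 → Fin 2 → ℝ
  form α β γ u w i j = α * (u i * u j) + β * (u i * w j + u j * w i) + γ * (w i * w j)

  -- With U = (u w) the form is U M Uᵀ for M = ((α β) (β γ)); conjugating by adj U gives det(U)² M.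
  form≡0⇒coefficients≡0 : ∀ {α β γ} {u w : Pt 2} → ¬ det u w ≡ 0ℝ →
    form α β γ u w 0F 0F ≡ 0ℝ → form α β γ u w 0F 1F ≡ 0ℝ → form α β γ u w 1F 1F ≡ 0ℝ →
    α ≡ 0ℝ × β ≡ 0ℝ × γ ≡ 0ℝ
  form≡0⇒coefficients≡0 {α} {β} {γ} {u} {w} det≢0 F₀₀≡0 F₀₁≡0 F₁₁≡0 =
    coefficient≡0 (solve 7 (λ α β γ u₀ u₁ w₀ w₁ →
      α :* (:det u₀ u₁ w₀ w₁ :* :det u₀ u₁ w₀ w₁) :=
        F α β γ u₀ u₀ w₀ w₀ :* (w₁ :* w₁) :- F α β γ u₀ u₁ w₀ w₁ :* (w₀ :* w₁ :+ w₀ :* w₁)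
        :+ F α β γ u₁ u₁ w₁ w₁ :* (w₀ :* w₀)) refl α β γ (u 0F) (u 1F) (w 0F) (w 1F)) ,
    coefficient≡0 (solve 7 (λ α β γ u₀ u₁ w₀ w₁ →
      β :* (:det u₀ u₁ w₀ w₁ :* :det u₀ u₁ w₀ w₁) :=
        F α β γ u₀ u₀ w₀ w₀ :* (:- (u₁ :* w₁)) :- F α β γ u₀ u₁ w₀ w₁ :* (:- (u₀ :* w₁ :+ u₁ :* w₀))
        :+ F α β γ u₁ u₁ w₁ w₁ :* (:- (u₀ :* w₀))) refl α β γ (u 0F) (u 1F) (w 0F) (w 1F)) ,
    coefficient≡0 (solve 7 (λ α β γ u₀ u₁ w₀ w₁ →
      γ :* (:det u₀ u₁ w₀ w₁ :* :det u₀ u₁ w₀ w₁) :=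
        F α β γ u₀ u₀ w₀ w₀ :* (u₁ :* u₁) :- F α β γ u₀ u₁ w₀ w₁ :* (u₀ :* u₁ :+ u₀ :* u₁)
        :+ F α β γ u₁ u₁ w₁ w₁ :* (u₀ :* u₀)) refl α β γ (u 0F) (u 1F) (w 0F) (w 1F))
    where
    F : ∀ {m} → Polynomial m → Polynomial m → Polynomial m → Polynomial m → Polynomial m →
        Polynomial m → Polynomial m → Polynomial m
    F α β γ uᵢ uⱼ wᵢ wⱼ = α :* (uᵢ :* uⱼ) :+ β :* (uᵢ :* wⱼ :+ uⱼ :* wᵢ) :+ γ :* (wᵢ :* wⱼ)
    det²≢0 : ¬ det u w * det u w ≡ 0ℝ
    det²≢0 det²≡0 = det≢0 (x*y≡0⇒x≡0 det≢0 det²≡0)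
    coefficient≡0 : ∀ {c x y z} → c * (det u w * det u w) ≡
      form α β γ u w 0F 0F * x - form α β γ u w 0F 1F * y + form α β γ u w 1F 1F * z → c ≡ 0ℝ
    coefficient≡0 c*det²≡ = x*y≡0⇒x≡0 det²≢0 (≡a*x-b*y+c*z⇒≡0 c*det²≡ F₀₀≡0 F₀₁≡0 F₁₁≡0)

  -- Minus the covariance of the coordinates i and j of p, q, r weighted by α, β, γ.
  affineCombination-product : ∀ {α β γ} → α + β + γ ≡ 1ℝ → ∀ (p q r : Pt 2) i j →
    (α * p i + β * q i + γ * r i) * (α * p j + β * q j + γ * r j)
      - (α * (p i * p j) + β * (q i * q j) + γ * (r i * r j))
    ≡ form (β * β - β) (β * γ) (γ * γ - γ) (q ⊝ p) (r ⊝ p) i j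
  affineCombination-product {β = β} {γ} Σ≡1 p q r i j with refl ← α≡1-β-γ Σ≡1 =
    solve 8 (λ β γ pᵢ pⱼ qᵢ qⱼ rᵢ rⱼ →
      let α = :1 :- β :- γ
      in (α :* pᵢ :+ β :* qᵢ :+ γ :* rᵢ) :* (α :* pⱼ :+ β :* qⱼ :+ γ :* rⱼ)
           :- (α :* (pᵢ :* pⱼ) :+ β :* (qᵢ :* qⱼ) :+ γ :* (rᵢ :* rⱼ))
         := (β :* β :- β) :* ((qᵢ :- pᵢ) :* (qⱼ :- pⱼ))
           :+ (β :* γ) :* ((qᵢ :- pᵢ) :* (rⱼ :- pⱼ) :+ (qⱼ :- pⱼ) :* (rᵢ :- pᵢ))
           :+ (γ :* γ :- γ) :* ((rᵢ :- pᵢ) :* (rⱼ :- pⱼ)))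
      refl β γ (p i) (p j) (q i) (q j) (r i) (r j)

  veronese∈affineSpan₃⇒vertex : ∀ {α β γ} {p q r s : Pt 2} → ¬ area p q r ≡ 0ℝ → α + β + γ ≡ 1ℝ →
    veronese s ≈ₚ (α · veronese p ⊕ β · veronese q ⊕ γ · veronese r) → Vertex α β γ
  veronese∈affineSpan₃⇒vertex {α} {β} {γ} {p} {q} {r} {s} area≢0 Σ≡1 Vs≈ =
    idempotent-weights⇒vertex Σ≡1 (proj₁ coefficients≡0) (proj₁ (proj₂ coefficients≡0))
                                  (proj₂ (proj₂ coefficients≡0))
    where
    sᵢ≡ : ∀ i → s i ≡ α * p i + β * q i + γ * r i
    sᵢ≡ 0F = Vs≈ 0F
    sᵢ≡ 1F = Vs≈ 1F
    form≡0 : ∀ i j → s i * s j ≡ α * (p i * p j) + β * (q i * q j) + γ * (r i * r j) →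
             form (β * β - β) (β * γ) (γ * γ - γ) (q ⊝ p) (r ⊝ p) i j ≡ 0ℝ
    form≡0 i j sᵢsⱼ≡m = begin
      form (β * β - β) (β * γ) (γ * γ - γ) (q ⊝ p) (r ⊝ p) i j
        ≡⟨ affineCombination-product Σ≡1 p q r i j ⟨
      (α * p i + β * q i + γ * r i) * (α * p j + β * q j + γ * r j) - m
        ≡⟨ cong₂ (λ x y → x * y - m) (sᵢ≡ i) (sᵢ≡ j) ⟨
      s i * s j - m  ≡⟨ cong (_- m) sᵢsⱼ≡m ⟩
      m - m          ≡⟨ solve 1 (λ x → x :- x := :0) refl m ⟩
      0ℝ             ∎
      where m = α * (p i * p j) + β * (q i * q j) + γ * (r i * r j)
    coefficients≡0 = form≡0⇒coefficients≡0 {u = q ⊝ p} {r ⊝ p} area≢0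
      (form≡0 0F 0F (Vs≈ 2F)) (form≡0 0F 1F (Vs≈ 3F)) (form≡0 1F 1F (Vs≈ 4F))

  veronese-image∩affineSpan₃⊆triangle : ∀ {S : Subset 2} {p q r} → ¬ area p q r ≡ 0ℝ → ∀ y →
    Image veronese S y → AffineSpan₃ (veronese p) (veronese q) (veronese r) y →
    Σ (Fin 3) λ i → y ≈ₚ triangle (veronese p) (veronese q) (veronese r) i
  veronese-image∩affineSpan₃⊆triangle {p = p} {q} {r} area≢0 y (s , _ , y≈Vs) (α , β , γ , Σ≡1 , y≈) =
    proj₁ vertex , λ j → trans (y≈ j) (proj₂ vertex j)
    where
    vertex : Σ (Fin 3) λ i → (α · veronese p ⊕ β · veronese q ⊕ γ · veronese r) ≈ₚ
                             triangle (veronese p) (veronese q) (veronese r) i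
    vertex = vertex⇒≈triangle
      (veronese∈affineSpan₃⇒vertex {s = s} area≢0 Σ≡1 (λ j → trans (sym (y≈Vs j)) (y≈ j)))

corollary3p3 : (ℛ : Reals) → let open Geometry ℛ in
    (S : Subset 2) (p q r : Pt 2) →
    S p → S q → S r → ¬ Collinear p q r →
    IsFlat 5 2 (AffineSpan₃ (veronese p) (veronese q) (veronese r)) ×
    IsOrdinaryFlat 5 2 (Image veronese S)
    (AffineSpan₃ (veronese p) (veronese q) (veronese r))
corollary3p3 ℛ S p q r Sp Sq Sr ¬collinear =
  isFlat , isFlat ,
  triangle (veronese p) (veronese q) (veronese r) ,
  area≢0⇒triangle-injective area≢0 ,
  (λ i → image∋triangle Sp Sq Sr i , affineSpan₃∋triangle i) ,
  veronese-image∩affineSpan₃⊆triangle area≢0 ,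
  (λ G G-isFlat G∋triangle →
     flat∋triangle⇒≐affineSpan₃ area≢0 G-isFlat (G∋triangle 0F) (G∋triangle 1F) (G∋triangle 2F))
  where
  open Reals ℛ using (0ℝ)
  open Geometry ℛ
  open Plane ℛ
  -- The first two coordinates of veronese x are those of x, so this is the area of p q r.
  area≢0 : ¬ area (veronese p) (veronese q) (veronese r) ≡ 0ℝ
  area≢0 = ¬collinear⇒area≢0 ¬collinear
  isFlat : IsFlat 5 2 (AffineSpan₃ (veronese p) (veronese q) (veronese r))
  isFlat = area≢0⇒isFlat area≢0
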